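{- Let $P=([n],\preceq)$ be a poset, $w$ a weight on $\mathbb{F}_q$, $\pi(i)=k_i$ a label map with $N=\sum_i k_i$. For every $1\le r\le M_w$, the number of $x\in\mathbb{F}_q^N$ with $w_{(P,w,\pi)}(x)=r$ is $$|A_r|=\sum_{j=1}^n\ \sum_{I\in\mathcal{I}_j^j}\ \sum_{\substack{b\in PRT_0[r]\\ b\text{ has } j\text{ parts}}}\ \sum_{(c_1,\dots,c_j)\in ARG[b]}\ \prod_{s=1}^j|D_{c_s}^{k_{i_s}}|,$$ where for $I\in\mathcal{I}_j^j$ we write $I=Max(I)=\{i_1,\dots,i_j\}$.
   Context: A weight on $\mathbb{F}_q$ is a map $w:\mathbb{F}_q\to\mathbb{N}\cup\{0\}$ with $w(\alpha)=0$ iff $\alpha=0$, $w(-\alpha)=w(\alpha)$, $w(\alpha+\beta)\le w(\alpha)+w(\beta)$; $M_w=\max_\alpha w(\alpha)$; $\tilde w^k(v)=\max_t w(v_t)$ for $v\in\mathbb{F}_q^k$; $D_r^k=\{u\in\mathbb{F}_q^k:\tilde w^k(u)=r\}$. Ideals of $P$ are down-closed subsets; $\langle A\rangle$ is the ideal generated by $A$; $Max(I)$ is the set of maximal elements of $I$; $\mathcal{I}_j^i$ is the set of ideals of cardinality $i$ with exactly $j$ maximal elements. Writing $x=x_1\oplus\cdots\oplus x_n\in\mathbb{F}_q^{k_1}\oplus\cdots\oplus\mathbb{F}_q^{k_n}=\mathbb{F}_q^N$, $supp_\pi(x)=\{i:x_i\ne0\}$, $I_x=\langle supp_\pi(x)\rangle$,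 $M_x=Max(I_x)$, and $w_{(P,w,\pi)}(x)=\sum_{i\in M_x}\tilde w^{k_i}(x_i)+|I_x\setminus M_x|\,M_w$; $A_r=\{x:w_{(P,w,\pi)}(x)=r\}$. For integers $m\ge0$, $PRT_m[r]$ is the set of non-increasing sequences $(b_1,\dots,b_t)$ of positive integers with $b_1+\dots+b_t=r-mM_w$, each $b_s\le M_w$ and $1\le t\le n-m$. For $b=(b_1,\dots,b_j)$, $ARG[b]$ is the set of distinct $j$-tuples obtained by permuting the entries of $b$. -}

module Defs where

open import Level using (0ℓ)
open import Data.Bool using (Bool; true; false; not)
open import Data.Nat using (ℕ; zero; suc; _+_; _*_; _∸_; _⊔_; _≥?_)
open import Data.Nat.Properties using (_≟_)
open import Data.Fin using (Fin; zero; suc)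
open import Data.Fin.Subset using (Subset; ∣_∣; _─_; _∈_)
open import Data.Fin.Subset.Properties using (_∈?_)
open import Data.Fin.Properties using (any?; all?)
open import Data.List using (List; []; _∷_; [_]; map; concatMap; filter; length;
  zipWith; upTo; allFin; foldr; deduplicate)
open import Data.Nat.ListAction using (sum; product)
open import Data.List.Properties using (≡-dec)
open import Data.List.Relation.Unary.Linked using (Linked; linked?)
open import Data.List.Relation.Unary.Unique.Propositional using (Unique)
open import Data.List.Membership.Propositional using () renaming (_∈_ to _∈ₗ_)
open import Data.Vec using (Vec; []; _∷_; tabulate)
import Data.Vec.Relation.Unary.All as VAll
open import Data.Product using (∃; _×_; _,_)
open import Relation.Nullary using (Dec; does; ¬_; _×-dec_; _→-dec_)
open import Relation.Binary using (Rel; IsDecPartialOrder; DecidableEquality)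
open import Relation.Binary.PropositionalEquality using (_≡_; _≢_)
open import Algebra.Structures using (IsCommutativeRing)
open import Data.Nat using (_≤_)

-- Equality is propositional; the field is enumerated by a duplicate-free
-- list containing every element, which is what cardinalities are
-- computed from.

record FiniteField : Set₁ where
  infixl 7 _*F_
  infixl 6 _+F_
  field
    Carrier  : Set
    _≟F_     : DecidableEquality Carrier
    _+F_ _*F_ : Carrier → Carrier → Carrier
    -F_      : Carrier → Carrier
    0# 1#    : Carrier
    isCommutativeRing : IsCommutativeRing _≡_ _+F_ _*F_ -F_ 0# 1#
    0≢1      : 0# ≢ 1#
    inverse  : ∀ x → x ≢ 0# → ∃ λ y → x *F y ≡ 1#
    elements : List Carrier
    complete : ∀ x → x ∈ₗ elements
    unique   : Unique elements

record Weight (F : FiniteField) : Set where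
  open FiniteField F
  field
    w       : Carrier → ℕ
    w≡0⇒    : ∀ α → w α ≡ 0 → α ≡ 0#
    w0      : w 0# ≡ 0
    w-neg   : ∀ α → w (-F α) ≡ w α
    w-tri   : ∀ α β → w (α +F β) ≤ w α + w β

allSubsets : (n : ℕ) → List (Subset n)
allSubsets zero    = [ [] ]
allSubsets (suc n) = concatMap (λ b → map (b ∷_) (allSubsets n)) (true ∷ false ∷ [])

listsOver : List ℕ → ℕ → List (List ℕ)
listsOver vals zero    = [ [] ]
listsOver vals (suc t) = concatMap (λ a → map (a ∷_) (listsOver vals t)) vals

oneTo : ℕ → List ℕ
oneTo m = map suc (upTo m)

inserts : ℕ → List ℕ → List (List ℕ)
inserts x []       = [ x ∷ [] ]
inserts x (y ∷ ys) = (x ∷ y ∷ ys) ∷ map (y ∷_) (inserts x ys)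

permutations : List ℕ → List (List ℕ)
permutations []       = [ [] ]
permutations (x ∷ xs) = concatMap (inserts x) (permutations xs)

ARG : List ℕ → List (List ℕ)
ARG b = deduplicate (≡-dec _≟_) (permutations b)

maxList : List ℕ → ℕ
maxList = foldr _⊔_ 0

module Vectors (F : FiniteField) where
  open FiniteField F

  allVecs : (m : ℕ) → List (Vec Carrier m)
  allVecs zero    = [ [] ]
  allVecs (suc m) = concatMap (λ a → map (a ∷_) (allVecs m)) elements

  consB : ∀ {n} {k : Fin (suc n) → ℕ} → Vec Carrier (k zero) →
          ((i : Fin n) → Vec Carrier (k (suc i))) → (i : Fin (suc n)) → Vec Carrier (k i)
  consB v f zero    = v
  consB v f (suc i) = f i

  -- all of F_q^{k_1} ⊕ ... ⊕ F_q^{k_n}  (= F_q^N)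
  allBlocks : (n : ℕ) (k : Fin n → ℕ) → List ((i : Fin n) → Vec Carrier (k i))
  allBlocks zero    k = [ (λ ()) ]
  allBlocks (suc n) k =
    concatMap (λ v → map (consB {n} {k} v) (allBlocks n (λ i → k (suc i)))) (allVecs (k zero))

  isZeroVec? : ∀ {m} (v : Vec Carrier m) → Dec (VAll.All (_≡ 0#) v)
  isZeroVec? = VAll.all? (λ a → a ≟F 0#)

module WeightDefs (F : FiniteField) (W : Weight F) where
  open FiniteField F
  open Weight W
  open Vectors F public

  Mw : ℕ
  Mw = maxList (map w elements)

  w̃ : ∀ {m} → Vec Carrier m → ℕ
  w̃ []       = 0
  w̃ (a ∷ v) = w a ⊔ w̃ v

  cardD : ℕ → ℕ → ℕ
  cardD r m = length (filter (λ u → w̃ u ≟ r) (allVecs m))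

  NonIncreasing : List ℕ → Set
  NonIncreasing = Linked (λ a b → a Data.Nat.≥ b)

  PRT : (n m r : ℕ) → List (List ℕ)
  PRT n m r =
    filter (λ b → linked? (λ a c → a ≥? c) b ×-dec (sum b + m * Mw ≟ r))
           (concatMap (listsOver (oneTo Mw)) (oneTo (n ∸ m)))

module PosetDefs {n : ℕ} (_≼_ : Rel (Fin n) 0ℓ)
                 (isDPO : IsDecPartialOrder _≡_ _≼_) where
  open IsDecPartialOrder isDPO using (_≤?_) renaming (_≟_ to _≟ᶠ_)

  IsIdeal : Subset n → Set
  IsIdeal I = ∀ i j → i ∈ I → j ≼ i → j ∈ I

  isIdeal? : (I : Subset n) → Dec (IsIdeal I)
  isIdeal? I = all? (λ i → all? (λ j → (i ∈? I) →-dec ((j ≤? i) →-dec (j ∈? I))))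

  ⟨_⟩ : Subset n → Subset n
  ⟨ A ⟩ = tabulate (λ j → does (any? (λ i → (i ∈? A) ×-dec (j ≤? i))))

  Max : Subset n → Subset n
  Max I = tabulate (λ i → does ((i ∈? I) ×-dec
            all? (λ j → (j ∈? I) →-dec ((i ≤? j) →-dec (j ≟ᶠ i)))))

  -- the elements of a subset, listed in increasing order i_1 < ... < i_j
  elems : Subset n → List (Fin n)
  elems I = filter (_∈? I) (allFin n)

  ideals : (i j : ℕ) → List (Subset n)
  ideals i j = filter (λ I → isIdeal? I ×-dec ((∣ I ∣ ≟ i) ×-dec (∣ Max I ∣ ≟ j))) (allSubsets n)

module Prop33 (F : FiniteField) (W : Weight F) {n : ℕ}
              (_≼_ : Rel (Fin n) 0ℓ) (isDPO : IsDecPartialOrder _≡_ _≼_)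
              (k : Fin n → ℕ) where
  open FiniteField F
  open Weight W
  open WeightDefs F W
  open PosetDefs _≼_ isDPO

  Space : Set
  Space = (i : Fin n) → Vec Carrier (k i)

  supp : Space → Subset n
  supp x = tabulate (λ i → not (does (isZeroVec? (x i))))

  Ix : Space → Subset n
  Ix x = ⟨ supp x ⟩

  Mx : Space → Subset n
  Mx x = Max (Ix x)

  wP : Space → ℕ
  wP x = sum (map (λ i → w̃ (x i)) (elems (Mx x))) + ∣ Ix x ─ Mx x ∣ * Mw

  cardA : ℕ → ℕ
  cardA r = length (filter (λ x → wP x ≟ r) (allBlocks n k))

  prodD : Subset n → List ℕ → ℕ
  prodD I c = product (zipWith (λ cs is → cardD cs (k is)) c (elems I))

  rhs : ℕ → ℕ
  rhs r =
    sum (map (λ j →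
      sum (map (λ I →
        sum (map (λ b →
          sum (map (λ c → prodD I c) (ARG b)))
          (filter (λ b → length b ≟ j) (PRT n 0 r))))
        (ideals j j)))
      (oneTo n))

-- If w_{(P,w,π)}(x) ≤ M_w, then every element of I_x is maximal: a non-maximal one would add
-- M_w on its own, and the maximal element above it, lying in supp(x), at least 1 more. Hence
-- supp(x) is an ideal all of whose elements are maximal (an ideal in 𝓘_j^j, j = |supp(x)|) and
-- the weight of x is the plain sum of the block weights w̃(x_i). Sorting the vectors x with a
-- given such support by their block weights (c_1, …, c_j) counts them as the sum of
-- ∏_s |D_{c_s}^{k_{i_s}}| over compositions c of r with parts in [1, M_w]; grouping the
-- compositions by the partition they rearrange (their decreasing sort) gives the sums over
-- PRT_0[r] and ARG[b].

module Submission where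

open import Defs
open import Level using (Level; 0ℓ)
open import Function using (_∘_; id)
open import Data.Bool using (Bool; true; false; not; if_then_else_)
open import Data.Empty using (⊥-elim)
open import Data.Fin using (Fin; zero; suc)
open import Data.Fin.Properties using (any?; all?)
open import Data.Fin.Subset using (Subset; ∣_∣; _─_; _⊆_) renaming (_∈_ to _∈ₛ_)
open import Data.Fin.Subset.Properties
  using (_∈?_; p⊂q⇒∣p∣<∣q∣; p⊆q⇒∣p∣≤∣q∣; ⊆-antisym; ∣⁅x⁆∣≡1; x∈⁅y⁆⇒x≡y; x∈p∧x∉q⇒x∈p─q; ∣p∣≤n)
open import Data.List using (List; []; _∷_; map; concatMap; filter; length; zipWith; _++_; allFin)
open import Data.List.Properties using (∷-injective; ≡-dec)
import Data.List.Properties as List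
open import Data.List.Membership.Propositional using (_∈_; _∉_; find; lose)
open import Data.List.Membership.Propositional.Properties
  using (∈-map⁺; ∈-map⁻; ∈-∃++; ∈-upTo⁺; ∈-upTo⁻; ∈-deduplicate⁺; ∈-deduplicate⁻; ∈-filter⁺; ∈-allFin)
open import Data.List.Relation.Unary.Any using (here; there)
open import Data.List.Relation.Unary.Any.Properties using (concatMap⁺; concatMap⁻)
open import Data.List.Relation.Unary.All using (All; []; _∷_)
import Data.List.Relation.Unary.All as All
open import Data.List.Relation.Unary.AllPairs using (_∷_)
open import Data.List.Relation.Unary.Unique.Propositional using (Unique)
open import Data.List.Relation.Unary.Unique.Propositional.Properties using (upTo⁺) renaming (map⁺ to Unique-map⁺)
open import Data.List.Relation.Unary.Unique.DecPropositional.Properties using (deduplicate-!)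
open import Data.List.Relation.Unary.Linked using (Linked; linked?)
open import Data.List.Relation.Binary.Permutation.Propositional using (_↭_; ↭-refl; ↭-sym; ↭-trans; ↭-prep; ↭-swap; ↭⇒↭ₛ)
open import Data.List.Relation.Binary.Permutation.Propositional.Properties
  using (↭-empty-inv; drop-mid; ∈-resp-↭; All-resp-↭; ↭-length)
open import Data.List.Relation.Binary.Equality.Propositional using (≋⇒≡)
import Data.List.Relation.Unary.Sorted.TotalOrder.Properties as Sorted
import Data.List.Sort as Sort
open import Data.Nat using (ℕ; zero; suc; _+_; _*_; _⊔_; _≤_; _<_; _≥_; _≥?_; z≤n; s≤s)
open import Data.Nat.Properties
open import Algebra.Properties.CommutativeSemigroup +-commutativeSemigroup using () renaming (interchange to +-interchange)
open import Algebra.Properties.CommutativeSemigroup *-commutativeSemigroup using () renaming (x∙yz≈y∙xz to x*yz≡y*xz)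
open import Data.Nat.ListAction using (sum; product)
open import Data.Nat.ListAction.Properties using (sum-++; sum-↭)
open import Data.Product using (∃; _×_; _,_; proj₁)
open import Data.Vec using (Vec; []; _∷_; tabulate)
open import Data.Vec.Properties using (lookup∘tabulate; []=⇒lookup; lookup⇒[]=)
open import Data.Vec.Relation.Unary.All using ([]; _∷_) renaming (All to VecAll)
open import Relation.Binary using (Rel; IsDecPartialOrder; DecidableEquality)
import Relation.Binary.Construct.Flip.EqAndOrd as Flip
open import Relation.Binary.PropositionalEquality
open import Relation.Nullary using (Dec; yes; no; does; ¬_; ¬?; _×-dec_; _→-dec_)
open import Relation.Nullary.Decidable using (dec-true; decidable-stable)
open import Relation.Unary using (Pred; Decidable)

open ≡-Reasoning

private variable
  a b p q : Level
  A B : Set a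
  P : Set p
  Q : Set q

-- Finite sums and indicators

∑ : List A → (A → ℕ) → ℕ
∑ xs f = sum (map f xs)

infix 8 ∑
syntax ∑ xs (λ x → e) = ∑[ x ∈ xs ] e

∑-cong-∈ : (xs : List A) {f g : A → ℕ} → (∀ x → x ∈ xs → f x ≡ g x) → ∑ xs f ≡ ∑ xs g
∑-cong-∈ []       eq = refl
∑-cong-∈ (x ∷ xs) eq = cong₂ _+_ (eq x (here refl)) (∑-cong-∈ xs (λ y → eq y ∘ there))

∑-cong : (xs : List A) {f g : A → ℕ} → (∀ x → f x ≡ g x) → ∑ xs f ≡ ∑ xs g
∑-cong xs eq = ∑-cong-∈ xs (λ x _ → eq x)

∑-++ : (xs ys : List A) (f : A → ℕ) → ∑ (xs ++ ys) f ≡ ∑ xs f + ∑ ys f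
∑-++ xs ys f = trans (cong sum (List.map-++ f xs ys)) (sum-++ (map f xs) (map f ys))

∑-map : (g : A → B) (xs : List A) (f : B → ℕ) → ∑ (map g xs) f ≡ ∑[ x ∈ xs ] f (g x)
∑-map g xs f = cong sum (sym (List.map-∘ xs))

∑-concatMap : (h : A → List B) (xs : List A) (f : B → ℕ) →
              ∑ (concatMap h xs) f ≡ ∑[ x ∈ xs ] ∑ (h x) f
∑-concatMap h []       f = refl
∑-concatMap h (x ∷ xs) f = trans (∑-++ (h x) (concatMap h xs) f) (cong (∑ (h x) f +_) (∑-concatMap h xs f))

∑-+ : (xs : List A) (f g : A → ℕ) → ∑[ x ∈ xs ] (f x + g x) ≡ ∑ xs f + ∑ xs g
∑-+ []       f g = refl
∑-+ (x ∷ xs) f g = trans (cong (f x + g x +_) (∑-+ xs f g)) (+-interchange (f x) (g x) _ _)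

∑-*ˡ : (xs : List A) (c : ℕ) (f : A → ℕ) → ∑[ x ∈ xs ] (c * f x) ≡ c * ∑ xs f
∑-*ˡ []       c f = sym (*-zeroʳ c)
∑-*ˡ (x ∷ xs) c f = trans (cong (c * f x +_) (∑-*ˡ xs c f)) (sym (*-distribˡ-+ c (f x) _))

∑-*ʳ : (xs : List A) (c : ℕ) (f : A → ℕ) → ∑[ x ∈ xs ] (f x * c) ≡ ∑ xs f * c
∑-*ʳ xs c f = begin
  ∑[ x ∈ xs ] (f x * c)  ≡⟨ ∑-cong xs (λ x → *-comm (f x) c) ⟩
  ∑[ x ∈ xs ] (c * f x)  ≡⟨ ∑-*ˡ xs c f ⟩
  c * ∑ xs f             ≡⟨ *-comm c _ ⟩
  ∑ xs f * c             ∎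

∑-zero : (xs : List A) → ∑[ x ∈ xs ] 0 ≡ 0
∑-zero []       = refl
∑-zero (x ∷ xs) = ∑-zero xs

∑-comm : (xs : List A) (ys : List B) (f : A → B → ℕ) →
         ∑[ x ∈ xs ] ∑[ y ∈ ys ] f x y ≡ ∑[ y ∈ ys ] ∑[ x ∈ xs ] f x y
∑-comm []       ys f = sym (∑-zero ys)
∑-comm (x ∷ xs) ys f = trans (cong (∑ ys (f x) +_) (∑-comm xs ys f)) (sym (∑-+ ys (f x) _))

∈⇒≤∑ : (xs : List A) (f : A → ℕ) {x : A} → x ∈ xs → f x ≤ ∑ xs f
∈⇒≤∑ (y ∷ ys) f (here refl) = m≤m+n (f y) _
∈⇒≤∑ (y ∷ ys) f (there x∈) = ≤-trans (∈⇒≤∑ ys f x∈) (m≤n+m _ (f y))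

𝟙 : Dec P → ℕ
𝟙 d = if does d then 1 else 0

𝟙-yes : (d : Dec P) → P → 𝟙 d ≡ 1
𝟙-yes (yes _) _  = refl
𝟙-yes (no ¬p) p = ⊥-elim (¬p p)

𝟙-no : (d : Dec P) → ¬ P → 𝟙 d ≡ 0
𝟙-no (yes p) ¬p = ⊥-elim (¬p p)
𝟙-no (no _)  _  = refl

𝟙-⇔ : (d : Dec P) (e : Dec Q) → (P → Q) → (Q → P) → 𝟙 d ≡ 𝟙 e
𝟙-⇔ d (yes q) _ Q⇒P = 𝟙-yes d (Q⇒P q)
𝟙-⇔ d (no ¬q) P⇒Q _ = 𝟙-no d (¬q ∘ P⇒Q)

𝟙-× : (d : Dec P) (e : Dec Q) → 𝟙 (d ×-dec e) ≡ 𝟙 d * 𝟙 e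
𝟙-× (yes _) (yes _) = refl
𝟙-× (yes _) (no _)  = refl
𝟙-× (no _)  _       = refl

module _ {P : Pred A p} (P? : Decidable P) where

  ∑-filter : (xs : List A) (f : A → ℕ) → ∑ (filter P? xs) f ≡ ∑[ x ∈ xs ] (𝟙 (P? x) * f x)
  ∑-filter []       f = refl
  ∑-filter (x ∷ xs) f with P? x
  ... | yes _ = cong₂ _+_ (sym (+-identityʳ (f x))) (∑-filter xs f)
  ... | no  _ = ∑-filter xs f

  length-filter≡∑𝟙 : (xs : List A) → length (filter P? xs) ≡ ∑[ x ∈ xs ] 𝟙 (P? x)
  length-filter≡∑𝟙 []       = refl
  length-filter≡∑𝟙 (x ∷ xs) with P? x
  ... | yes _ = cong suc (length-filter≡∑𝟙 xs)
  ... | no  _ = length-filter≡∑𝟙 xs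

module Multiplicity {A : Set a} (_≟ᴬ_ : DecidableEquality A) where

  δ : A → A → ℕ
  δ x y = 𝟙 (x ≟ᴬ y)

  count : A → List A → ℕ
  count y xs = ∑[ z ∈ xs ] δ z y

  δ-refl : ∀ x → δ x x ≡ 1
  δ-refl x = 𝟙-yes (x ≟ᴬ x) refl

  δ-≢ : ∀ {x y} → x ≢ y → δ x y ≡ 0
  δ-≢ {x} {y} = 𝟙-no (x ≟ᴬ y)

  δ-sym : ∀ x y → δ x y ≡ δ y x
  δ-sym x y = 𝟙-⇔ (x ≟ᴬ y) (y ≟ᴬ x) sym sym

  δ-sift : ∀ x y (f : A → ℕ) → δ x y * f x ≡ δ x y * f y
  δ-sift x y f with x ≟ᴬ y
  ... | yes refl = refl
  ... | no  _    = refl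

  ∑-δ : (xs : List A) (y : A) (f : A → ℕ) → ∑[ x ∈ xs ] (δ x y * f x) ≡ count y xs * f y
  ∑-δ xs y f = trans (∑-cong xs (λ x → δ-sift x y f)) (∑-*ʳ xs (f y) (λ x → δ x y))

  count-∉ : ∀ y (xs : List A) → y ∉ xs → count y xs ≡ 0
  count-∉ y []       _   = refl
  count-∉ y (x ∷ xs) y∉ = cong₂ _+_ (δ-≢ (λ x≡y → y∉ (here (sym x≡y)))) (count-∉ y xs (y∉ ∘ there))

  count-unique : ∀ y {xs : List A} → Unique xs → y ∈ xs → count y xs ≡ 1
  count-unique y {x ∷ xs} (x∉xs ∷ _) (here refl) =
    cong₂ _+_ (δ-refl y) (count-∉ y xs (λ y∈ → All.lookup x∉xs y∈ refl))
  count-unique y {x ∷ xs} (x∉xs ∷ u) (there y∈) =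
    cong₂ _+_ (δ-≢ λ { refl → All.lookup x∉xs y∈ refl }) (count-unique y u y∈)

  ∑-reindex : (xs ys : List A) (f : A → ℕ) → (∀ x → x ∈ xs → count x ys ≡ 1) →
              ∑ xs f ≡ ∑[ y ∈ ys ] (count y xs * f y)
  ∑-reindex xs ys f once = sym (begin
    ∑[ y ∈ ys ] (count y xs * f y)           ≡⟨ ∑-cong ys (λ y → sym (∑-*ʳ xs (f y) (λ x → δ x y))) ⟩
    ∑[ y ∈ ys ] ∑[ x ∈ xs ] (δ x y * f y)    ≡⟨ ∑-comm ys xs _ ⟩
    ∑[ x ∈ xs ] ∑[ y ∈ ys ] (δ x y * f y)    ≡⟨ ∑-cong-∈ xs sift ⟩
    ∑ xs f                                   ∎)
    where
    sift : ∀ x → x ∈ xs → ∑[ y ∈ ys ] (δ x y * f y) ≡ f x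
    sift x x∈ = begin
      ∑[ y ∈ ys ] (δ x y * f y)  ≡⟨ ∑-cong ys (λ y → cong (_* f y) (δ-sym x y)) ⟩
      ∑[ y ∈ ys ] (δ y x * f y)  ≡⟨ ∑-δ ys x f ⟩
      count x ys * f x           ≡⟨ cong (_* f x) (once x x∈) ⟩
      1 * f x                    ≡⟨ *-identityˡ (f x) ⟩
      f x                        ∎

-- Permutations, compositions and partitions

∈-inserts⁻ : ∀ x ys {zs} → zs ∈ inserts x ys → zs ↭ x ∷ ys
∈-inserts⁻ x []       (here refl) = ↭-refl
∈-inserts⁻ x (y ∷ ys) (here refl) = ↭-refl
∈-inserts⁻ x (y ∷ ys) (there zs∈) with _ , zs′∈ , refl ← ∈-map⁻ (y ∷_) zs∈ =
  ↭-trans (↭-prep y (∈-inserts⁻ x ys zs′∈)) (↭-swap y x ↭-refl)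

∈-inserts⁺ : ∀ x us vs → us ++ x ∷ vs ∈ inserts x (us ++ vs)
∈-inserts⁺ x []       []       = here refl
∈-inserts⁺ x []       (v ∷ vs) = here refl
∈-inserts⁺ x (u ∷ us) vs       = there (∈-map⁺ (u ∷_) (∈-inserts⁺ x us vs))

∈-permutations⁻ : ∀ xs {ys} → ys ∈ permutations xs → ys ↭ xs
∈-permutations⁻ []       (here refl) = ↭-refl
∈-permutations⁻ (x ∷ xs) ys∈ with zs , zs∈ , ys∈′ ← find (concatMap⁻ (inserts x) ys∈) =
  ↭-trans (∈-inserts⁻ x zs ys∈′) (↭-prep x (∈-permutations⁻ xs zs∈))

∈-permutations⁺ : ∀ xs {ys} → ys ↭ xs → ys ∈ permutations xs
∈-permutations⁺ []       ys↭ rewrite ↭-empty-inv ys↭ = here refl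
∈-permutations⁺ (x ∷ xs) ys↭ with us , vs , refl ← ∈-∃++ (∈-resp-↭ (↭-sym ys↭) (here refl)) =
  concatMap⁺ (inserts x) (lose (∈-permutations⁺ xs (drop-mid us [] ys↭)) (∈-inserts⁺ x us vs))

module ℕ-Multiplicity = Multiplicity _≟_
module List-Multiplicity = Multiplicity (≡-dec _≟_)

∈-ARG⁻ : ∀ bs {cs} → cs ∈ ARG bs → cs ↭ bs
∈-ARG⁻ bs = ∈-permutations⁻ bs ∘ ∈-deduplicate⁻ (≡-dec _≟_) (permutations bs)

count-ARG-↭ : ∀ bs cs → cs ↭ bs → List-Multiplicity.count cs (ARG bs) ≡ 1
count-ARG-↭ bs cs cs↭ = List-Multiplicity.count-unique cs (deduplicate-! (≡-dec _≟_) (permutations bs))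
  (∈-deduplicate⁺ (≡-dec _≟_) (∈-permutations⁺ bs cs↭))

count-ARG-¬↭ : ∀ bs cs → ¬ (cs ↭ bs) → List-Multiplicity.count cs (ARG bs) ≡ 0
count-ARG-¬↭ bs cs cs≁ = List-Multiplicity.count-∉ cs (ARG bs) (cs≁ ∘ ∈-ARG⁻ bs)

∈-oneTo⁻ : ∀ {m x} → x ∈ oneTo m → 1 ≤ x × x ≤ m
∈-oneTo⁻ x∈ with _ , i∈ , refl ← ∈-map⁻ suc x∈ = s≤s z≤n , ∈-upTo⁻ i∈

∈-oneTo⁺ : ∀ {m x} → 1 ≤ x → x ≤ m → x ∈ oneTo m
∈-oneTo⁺ {x = suc x} _ x<m = ∈-map⁺ suc (∈-upTo⁺ x<m)

oneTo-unique : ∀ m → Unique (oneTo m)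
oneTo-unique m = Unique-map⁺ suc-injective (upTo⁺ m)

count-oneTo : ∀ {m x} → 1 ≤ x → x ≤ m → ℕ-Multiplicity.count x (oneTo m) ≡ 1
count-oneTo {m} {x} 1≤x x≤m = ℕ-Multiplicity.count-unique x (oneTo-unique m) (∈-oneTo⁺ 1≤x x≤m)

∈-listsOver⁻ : ∀ vs t {cs} → cs ∈ listsOver vs t → length cs ≡ t × All (_∈ vs) cs
∈-listsOver⁻ vs zero    (here refl) = refl , []
∈-listsOver⁻ vs (suc t) cs∈
  with v , v∈ , cs∈′ ← find (concatMap⁻ (λ v → map (v ∷_) (listsOver vs t)) {xs = vs} cs∈)
  with ds , ds∈ , refl ← ∈-map⁻ (v ∷_) cs∈′
  with refl , ds⊆ ← ∈-listsOver⁻ vs t ds∈ = refl , v∈ ∷ ds⊆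

δ-∷ : ∀ x y xs ys → List-Multiplicity.δ (x ∷ xs) (y ∷ ys) ≡ ℕ-Multiplicity.δ x y * List-Multiplicity.δ xs ys
δ-∷ x y xs ys = trans
  (𝟙-⇔ (≡-dec _≟_ (x ∷ xs) (y ∷ ys)) (x ≟ y ×-dec ≡-dec _≟_ xs ys) ∷-injective (λ (x≡y , xs≡ys) → cong₂ _∷_ x≡y xs≡ys))
  (𝟙-× (x ≟ y) (≡-dec _≟_ xs ys))

count-listsOver : ∀ {vs} t cs → Unique vs → length cs ≡ t → All (_∈ vs) cs →
                  List-Multiplicity.count cs (listsOver vs t) ≡ 1
count-listsOver zero    []       _ refl [] = refl
count-listsOver {vs} (suc t) (c ∷ cs) u refl (c∈ ∷ cs⊆) = begin
  count (c ∷ cs) (concatMap (λ v → map (v ∷_) (listsOver vs t)) vs)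
    ≡⟨ ∑-concatMap _ vs _ ⟩
  ∑[ v ∈ vs ] ∑[ ds ∈ map (v ∷_) (listsOver vs t) ] δ ds (c ∷ cs)
    ≡⟨ ∑-cong vs (λ v → ∑-map (v ∷_) (listsOver vs t) _) ⟩
  ∑[ v ∈ vs ] ∑[ ds ∈ listsOver vs t ] δ (v ∷ ds) (c ∷ cs)
    ≡⟨ ∑-cong vs (λ v → trans (∑-cong (listsOver vs t) (λ ds → δ-∷ v c ds cs))
                   (∑-*ˡ (listsOver vs t) (ℕ-Multiplicity.δ v c) (λ ds → δ ds cs))) ⟩
  ∑[ v ∈ vs ] (ℕ-Multiplicity.δ v c * count cs (listsOver vs t))
    ≡⟨ ℕ-Multiplicity.∑-δ vs c (λ _ → count cs (listsOver vs t)) ⟩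
  ℕ-Multiplicity.count c vs * count cs (listsOver vs t)
    ≡⟨ cong₂ _*_ (ℕ-Multiplicity.count-unique c u c∈) (count-listsOver t cs u refl cs⊆) ⟩
  1 ∎
  where open List-Multiplicity

module Descending = Sort (Flip.decTotalOrder ≤-decTotalOrder)

sortDesc : List ℕ → List ℕ
sortDesc = Descending.sort

sortDesc-↭ : ∀ xs → sortDesc xs ↭ xs
sortDesc-↭ = Descending.sort-↭

sortDesc-nonIncreasing : ∀ xs → Linked _≥_ (sortDesc xs)
sortDesc-nonIncreasing = Descending.sort-↗

nonIncreasing-↭⇒≡ : ∀ {xs ys} → Linked _≥_ xs → Linked _≥_ ys → xs ↭ ys → xs ≡ ys
nonIncreasing-↭⇒≡ xs↘ ys↘ xs↭ys =
  ≋⇒≡ (Sorted.↗↭↗⇒≋ (Flip.totalOrder ≤-totalOrder) xs↘ ys↘ (↭⇒↭ₛ xs↭ys))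

module Partitions (F : FiniteField) (W : Weight F) (r : ℕ) where
  open WeightDefs F W
  open List-Multiplicity

  compositions : ℕ → List (List ℕ)
  compositions = listsOver (oneTo Mw)

  -- the filter predicate of PRT n 0 r, whence the vacuous + 0 * Mw
  isPartition? : (bs : List ℕ) → Dec (NonIncreasing bs × sum bs + 0 * Mw ≡ r)
  isPartition? bs = linked? (λ x y → x ≥? y) bs ×-dec (sum bs + 0 * Mw ≟ r)

  count-compositions-↭ : ∀ j {bs cs} → bs ∈ compositions j → cs ↭ bs → count cs (compositions j) ≡ 1
  count-compositions-↭ j {bs} {cs} bs∈ cs↭bs with length-bs , bs⊆ ← ∈-listsOver⁻ (oneTo Mw) j bs∈ =
    count-listsOver j cs (oneTo-unique Mw) (trans (↭-length cs↭bs) length-bs) (All-resp-↭ (↭-sym cs↭bs) bs⊆)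

  -- a composition cs is an arrangement of exactly one partition, namely sortDesc cs
  partition-arrangements : ∀ bs cs → 𝟙 (isPartition? bs) * count cs (ARG bs) ≡ δ bs (sortDesc cs) * 𝟙 (sum cs ≟ r)
  partition-arrangements bs cs with ≡-dec _≟_ bs (sortDesc cs)
  ... | yes refl = trans (cong₂ _*_
          (𝟙-⇔ (isPartition? bs) (sum cs ≟ r)
            (λ (_ , sum≡r) → trans (sym (sum-↭ (sortDesc-↭ cs))) (trans (sym (+-identityʳ _)) sum≡r))
            (λ sum≡r → sortDesc-nonIncreasing cs , trans (+-identityʳ _) (trans (sum-↭ (sortDesc-↭ cs)) sum≡r)))
          (count-ARG-↭ bs cs (↭-sym (sortDesc-↭ cs))))
          (*-comm _ 1)
  ... | no bs≢ = no-arrangement (isPartition? bs)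
    where
    no-arrangement : (d : Dec (NonIncreasing bs × sum bs + 0 * Mw ≡ r)) → 𝟙 d * count cs (ARG bs) ≡ 0
    no-arrangement (no _)          = refl
    no-arrangement (yes (bs↘ , _)) = trans (*-identityˡ _) (count-ARG-¬↭ bs cs λ cs↭bs →
      bs≢ (nonIncreasing-↭⇒≡ bs↘ (sortDesc-nonIncreasing cs) (↭-trans (↭-sym cs↭bs) (↭-sym (sortDesc-↭ cs)))))

  ∑-partitions-count-ARG : ∀ j {cs} → cs ∈ compositions j →
    ∑[ bs ∈ compositions j ] (𝟙 (isPartition? bs) * count cs (ARG bs)) ≡ 𝟙 (sum cs ≟ r)
  ∑-partitions-count-ARG j {cs} cs∈ = begin
    ∑[ bs ∈ compositions j ] (𝟙 (isPartition? bs) * count cs (ARG bs))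
      ≡⟨ ∑-cong (compositions j) (λ bs → partition-arrangements bs cs) ⟩
    ∑[ bs ∈ compositions j ] (δ bs (sortDesc cs) * 𝟙 (sum cs ≟ r))
      ≡⟨ ∑-*ʳ (compositions j) _ _ ⟩
    count (sortDesc cs) (compositions j) * 𝟙 (sum cs ≟ r)
      ≡⟨ cong (_* 𝟙 (sum cs ≟ r)) (count-compositions-↭ j cs∈ (sortDesc-↭ cs)) ⟩
    1 * 𝟙 (sum cs ≟ r)
      ≡⟨ *-identityˡ _ ⟩
    𝟙 (sum cs ≟ r) ∎

  ∑-partitions-ARG : ∀ j (f : List ℕ → ℕ) →
    ∑[ bs ∈ compositions j ] (𝟙 (isPartition? bs) * ∑ (ARG bs) f) ≡ ∑[ cs ∈ compositions j ] (𝟙 (sum cs ≟ r) * f cs)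
  ∑-partitions-ARG j f = begin
    ∑[ bs ∈ L ] (𝟙 (isPartition? bs) * ∑ (ARG bs) f)
      ≡⟨ ∑-cong-∈ L (λ bs bs∈ → cong (𝟙 (isPartition? bs) *_)
           (∑-reindex (ARG bs) L f (λ cs cs∈ → count-compositions-↭ j bs∈ (∈-ARG⁻ bs cs∈)))) ⟩
    ∑[ bs ∈ L ] (𝟙 (isPartition? bs) * (∑[ cs ∈ L ] (count cs (ARG bs) * f cs)))
      ≡⟨ ∑-cong L (λ bs → sym (∑-*ˡ L (𝟙 (isPartition? bs)) _)) ⟩
    ∑[ bs ∈ L ] ∑[ cs ∈ L ] (𝟙 (isPartition? bs) * (count cs (ARG bs) * f cs))
      ≡⟨ ∑-comm L L _ ⟩
    ∑[ cs ∈ L ] ∑[ bs ∈ L ] (𝟙 (isPartition? bs) * (count cs (ARG bs) * f cs))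
      ≡⟨ ∑-cong L (λ cs → trans (∑-cong L (λ bs → sym (*-assoc (𝟙 (isPartition? bs)) _ _))) (∑-*ʳ L (f cs) _)) ⟩
    ∑[ cs ∈ L ] ((∑[ bs ∈ L ] (𝟙 (isPartition? bs) * count cs (ARG bs))) * f cs)
      ≡⟨ ∑-cong-∈ L (λ cs cs∈ → cong (_* f cs) (∑-partitions-count-ARG j cs∈)) ⟩
    ∑[ cs ∈ L ] (𝟙 (sum cs ≟ r) * f cs) ∎
    where L = compositions j

  ∑-PRT-ARG : ∀ n j → 1 ≤ j → j ≤ n → (f : List ℕ → ℕ) →
    ∑[ bs ∈ filter (λ bs → length bs ≟ j) (PRT n 0 r) ] ∑ (ARG bs) f ≡ ∑[ cs ∈ compositions j ] (𝟙 (sum cs ≟ r) * f cs)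
  ∑-PRT-ARG n j 1≤j j≤n f = begin
    ∑[ bs ∈ filter (λ bs → length bs ≟ j) (PRT n 0 r) ] arrangements bs
      ≡⟨ ∑-filter (λ bs → length bs ≟ j) (PRT n 0 r) arrangements ⟩
    ∑[ bs ∈ filter isPartition? (concatMap compositions (oneTo n)) ] (𝟙 (length bs ≟ j) * arrangements bs)
      ≡⟨ ∑-filter isPartition? (concatMap compositions (oneTo n)) _ ⟩
    ∑[ bs ∈ concatMap compositions (oneTo n) ] (𝟙 (isPartition? bs) * (𝟙 (length bs ≟ j) * arrangements bs))
      ≡⟨ ∑-concatMap compositions (oneTo n) _ ⟩
    ∑[ t ∈ oneTo n ] ∑[ bs ∈ compositions t ] (𝟙 (isPartition? bs) * (𝟙 (length bs ≟ j) * arrangements bs))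
      ≡⟨ ∑-cong (oneTo n) (λ t → trans (∑-cong-∈ (compositions t) (𝟙-length≡δ t))
                                           (∑-*ˡ (compositions t) (ℕ-Multiplicity.δ t j) _)) ⟩
    ∑[ t ∈ oneTo n ] (ℕ-Multiplicity.δ t j * g t)
      ≡⟨ ℕ-Multiplicity.∑-δ (oneTo n) j g ⟩
    ℕ-Multiplicity.count j (oneTo n) * g j
      ≡⟨ cong (_* g j) (count-oneTo 1≤j j≤n) ⟩
    1 * g j
      ≡⟨ *-identityˡ (g j) ⟩
    g j
      ≡⟨ ∑-partitions-ARG j f ⟩
    ∑[ cs ∈ compositions j ] (𝟙 (sum cs ≟ r) * f cs) ∎
    where
    arrangements : List ℕ → ℕ
    arrangements bs = ∑ (ARG bs) f
    g : ℕ → ℕ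
    g t = ∑[ bs ∈ compositions t ] (𝟙 (isPartition? bs) * arrangements bs)
    𝟙-length≡δ : ∀ t bs → bs ∈ compositions t →
      𝟙 (isPartition? bs) * (𝟙 (length bs ≟ j) * arrangements bs) ≡ ℕ-Multiplicity.δ t j * (𝟙 (isPartition? bs) * arrangements bs)
    𝟙-length≡δ t bs bs∈ rewrite proj₁ (∈-listsOver⁻ (oneTo Mw) t bs∈) =
      x*yz≡y*xz (𝟙 (isPartition? bs)) (ℕ-Multiplicity.δ t j) (arrangements bs)

-- Subsets of Fin n

∑-allFin-suc : ∀ {n} (f : Fin (suc n) → ℕ) → ∑ (allFin (suc n)) f ≡ f zero + ∑[ i ∈ allFin n ] f (suc i)
∑-allFin-suc {n} f = cong (f zero +_) (trans (cong (λ is → ∑ is f) (sym (List.map-tabulate id suc))) (∑-map suc (allFin n) f))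

∑-allSubsets-suc : ∀ {n} (g : Subset (suc n) → ℕ) →
  ∑ (allSubsets (suc n)) g ≡ ∑[ S ∈ allSubsets n ] g (true ∷ S) + ∑[ S ∈ allSubsets n ] g (false ∷ S)
∑-allSubsets-suc {n} g = begin
  ∑ (map (true ∷_) (allSubsets n) ++ map (false ∷_) (allSubsets n) ++ []) g
    ≡⟨ ∑-concatMap (λ b → map (b ∷_) (allSubsets n)) (true ∷ false ∷ []) g ⟩
  ∑ (map (true ∷_) (allSubsets n)) g + (∑ (map (false ∷_) (allSubsets n)) g + 0)
    ≡⟨ cong₂ _+_ (∑-map (true ∷_) (allSubsets n) g) (trans (+-identityʳ _) (∑-map (false ∷_) (allSubsets n) g)) ⟩
  ∑[ S ∈ allSubsets n ] g (true ∷ S) + ∑[ S ∈ allSubsets n ] g (false ∷ S) ∎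

blockDims : ∀ {n} → (Fin n → ℕ) → Subset n → List ℕ
blockDims k []          = []
blockDims k (true ∷ S)  = k zero ∷ blockDims (k ∘ suc) S
blockDims k (false ∷ S) = blockDims (k ∘ suc) S

∣p─p∣≡0 : ∀ {n} (p : Subset n) → ∣ p ─ p ∣ ≡ 0
∣p─p∣≡0 []          = refl
∣p─p∣≡0 (true ∷ p)  = ∣p─p∣≡0 p
∣p─p∣≡0 (false ∷ p) = ∣p─p∣≡0 p

∈⇒1≤∣∣ : ∀ {n} {p : Subset n} {i} → i ∈ₛ p → 1 ≤ ∣ p ∣
∈⇒1≤∣∣ {p = p} {i} i∈ = subst (_≤ ∣ p ∣) (∣⁅x⁆∣≡1 i)
  (p⊆q⇒∣p∣≤∣q∣ λ j∈ → subst (_∈ₛ p) (sym (x∈⁅y⁆⇒x≡y i j∈)) i∈)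

⊆∧∣∣≡⇒≡ : ∀ {n} {p q : Subset n} → p ⊆ q → ∣ p ∣ ≡ ∣ q ∣ → p ≡ q
⊆∧∣∣≡⇒≡ {p = p} {q} p⊆q ∣p∣≡∣q∣ with any? (λ i → (i ∈? q) ×-dec ¬? (i ∈? p))
... | yes (i , i∈q , i∉p) = ⊥-elim (<⇒≢ (p⊂q⇒∣p∣<∣q∣ (p⊆q , i , i∈q , i∉p)) ∣p∣≡∣q∣)
... | no  ∄i             = ⊆-antisym p⊆q λ {i} i∈q → decidable-stable (i ∈? p) (λ i∉p → ∄i (i , i∈q , i∉p))

filter-∈-map-suc : ∀ {n} b (S : Subset n) is → filter (_∈? (b ∷ S)) (map suc is) ≡ map suc (filter (_∈? S) is)
filter-∈-map-suc b S []       = refl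
filter-∈-map-suc b S (i ∷ is) with does (i ∈? S)
... | true  = cong (suc i ∷_) (filter-∈-map-suc b S is)
... | false = filter-∈-map-suc b S is

filter-∈-allFin-suc : ∀ {n} b (S : Subset n) →
  filter (_∈? (b ∷ S)) (allFin (suc n)) ≡ filter (_∈? (b ∷ S)) (zero ∷ map suc (allFin n))
filter-∈-allFin-suc {n} b S = cong (λ is → filter (_∈? (b ∷ S)) (zero ∷ is)) (sym (List.map-tabulate id suc))

map-elems≡blockDims : ∀ {n} (k : Fin n → ℕ) (S : Subset n) → map k (filter (_∈? S) (allFin n)) ≡ blockDims k S
map-elems≡blockDims k []          = refl
map-elems≡blockDims {suc n} k (true ∷ S) = begin
  map k (filter (_∈? (true ∷ S)) (allFin (suc n)))    ≡⟨ cong (map k) (filter-∈-allFin-suc true S) ⟩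
  k zero ∷ map k (filter (_∈? (true ∷ S)) (map suc (allFin n)))
    ≡⟨ cong (λ is → k zero ∷ map k is) (filter-∈-map-suc true S (allFin n)) ⟩
  k zero ∷ map k (map suc (filter (_∈? S) (allFin n)))
    ≡⟨ cong (k zero ∷_) (trans (sym (List.map-∘ _)) (map-elems≡blockDims (k ∘ suc) S)) ⟩
  k zero ∷ blockDims (k ∘ suc) S                      ∎
map-elems≡blockDims {suc n} k (false ∷ S) = begin
  map k (filter (_∈? (false ∷ S)) (allFin (suc n)))   ≡⟨ cong (map k) (filter-∈-allFin-suc false S) ⟩
  map k (filter (_∈? (false ∷ S)) (map suc (allFin n)))
    ≡⟨ cong (map k) (filter-∈-map-suc false S (allFin n)) ⟩
  map k (map suc (filter (_∈? S) (allFin n)))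
    ≡⟨ trans (sym (List.map-∘ _)) (map-elems≡blockDims (k ∘ suc) S) ⟩
  blockDims (k ∘ suc) S                               ∎

length-blockDims : ∀ {n} (k : Fin n → ℕ) (S : Subset n) → length (blockDims k S) ≡ ∣ S ∣
length-blockDims k []          = refl
length-blockDims k (true ∷ S)  = cong suc (length-blockDims (k ∘ suc) S)
length-blockDims k (false ∷ S) = length-blockDims (k ∘ suc) S

-- Counting vectors by support and weight

∈⇒≤maxList : ∀ {x xs} → x ∈ xs → x ≤ maxList xs
∈⇒≤maxList {x} (here refl)          = m≤m⊔n x _
∈⇒≤maxList {xs = y ∷ _} (there x∈) = ≤-trans (∈⇒≤maxList x∈) (m≤n⊔m y _)

module Weights (F : FiniteField) (W : Weight F) where
  open FiniteField F
  open Weight W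
  open WeightDefs F W
  module F-Multiplicity = Multiplicity _≟F_

  nonzero : ∀ {m} → Vec Carrier m → Bool
  nonzero v = not (does (isZeroVec? v))

  w̃-zero : ∀ {m} {v : Vec Carrier m} → VecAll (_≡ 0#) v → w̃ v ≡ 0
  w̃-zero []             = refl
  w̃-zero (refl ∷ v≡0) = cong₂ _⊔_ w0 (w̃-zero v≡0)

  w̃≡0⇒zero : ∀ {m} (v : Vec Carrier m) → w̃ v ≡ 0 → VecAll (_≡ 0#) v
  w̃≡0⇒zero []      _     = []
  w̃≡0⇒zero (a ∷ v) w̃≡0 =
    w≡0⇒ a (n≤0⇒n≡0 (m⊔n≤o⇒m≤o (w a) (w̃ v) (≤-reflexive w̃≡0))) ∷
    w̃≡0⇒zero v (n≤0⇒n≡0 (m⊔n≤o⇒n≤o (w a) (w̃ v) (≤-reflexive w̃≡0)))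

  w̃≤Mw : ∀ {m} (v : Vec Carrier m) → w̃ v ≤ Mw
  w̃≤Mw []      = z≤n
  w̃≤Mw (a ∷ v) = ⊔-lub (∈⇒≤maxList (∈-map⁺ w (complete a))) (w̃≤Mw v)

  nonzero⇒w̃≥1 : ∀ {m} (v : Vec Carrier m) → ¬ VecAll (_≡ 0#) v → 1 ≤ w̃ v
  nonzero⇒w̃≥1 v v≢0 with w̃ v in w̃≡
  ... | zero  = ⊥-elim (v≢0 (w̃≡0⇒zero v w̃≡))
  ... | suc _ = s≤s z≤n

  𝟙-isZeroVec-∷ : ∀ {m} a (v : Vec Carrier m) →
                  𝟙 (isZeroVec? (a ∷ v)) ≡ F-Multiplicity.δ a 0# * 𝟙 (isZeroVec? v)
  𝟙-isZeroVec-∷ a v = trans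
    (𝟙-⇔ (isZeroVec? (a ∷ v)) ((a ≟F 0#) ×-dec isZeroVec? v)
      (λ { (a≡0 ∷ v≡0) → a≡0 , v≡0 }) (λ (a≡0 , v≡0) → a≡0 ∷ v≡0))
    (𝟙-× (a ≟F 0#) (isZeroVec? v))

  ∑-isZeroVec : ∀ m → ∑[ v ∈ allVecs m ] 𝟙 (isZeroVec? v) ≡ 1
  ∑-isZeroVec zero    = refl
  ∑-isZeroVec (suc m) = begin
    ∑[ v ∈ concatMap (λ a → map (a ∷_) (allVecs m)) elements ] 𝟙 (isZeroVec? v)
      ≡⟨ ∑-concatMap _ elements _ ⟩
    ∑[ a ∈ elements ] ∑[ v ∈ map (a ∷_) (allVecs m) ] 𝟙 (isZeroVec? v)
      ≡⟨ ∑-cong elements (λ a → ∑-map (a ∷_) (allVecs m) _) ⟩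
    ∑[ a ∈ elements ] ∑[ v ∈ allVecs m ] 𝟙 (isZeroVec? (a ∷ v))
      ≡⟨ ∑-cong elements (λ a → trans (∑-cong (allVecs m) (𝟙-isZeroVec-∷ a))
                                       (∑-*ˡ (allVecs m) (F-Multiplicity.δ a 0#) _)) ⟩
    ∑[ a ∈ elements ] (F-Multiplicity.δ a 0# * ∑[ v ∈ allVecs m ] 𝟙 (isZeroVec? v))
      ≡⟨ F-Multiplicity.∑-δ elements 0# _ ⟩
    F-Multiplicity.count 0# elements * ∑[ v ∈ allVecs m ] 𝟙 (isZeroVec? v)
      ≡⟨ cong₂ _*_ (F-Multiplicity.count-unique 0# unique (complete 0#)) (∑-isZeroVec m) ⟩
    1 ∎

  𝟙-nonzero≡count-w̃ : ∀ {m} (v : Vec Carrier m) → 𝟙 (¬? (isZeroVec? v)) ≡ ℕ-Multiplicity.count (w̃ v) (oneTo Mw)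
  𝟙-nonzero≡count-w̃ v with isZeroVec? v
  ... | yes v≡0 = sym (ℕ-Multiplicity.count-∉ (w̃ v) (oneTo Mw) λ w̃∈ →
                    <⇒≢ (proj₁ (∈-oneTo⁻ w̃∈)) (sym (w̃-zero v≡0)))
  ... | no  v≢0 = sym (count-oneTo (nonzero⇒w̃≥1 v v≢0) (w̃≤Mw v))

  ∑-nonzero-byWeight : ∀ m (ψ : ℕ → ℕ) →
    ∑[ v ∈ allVecs m ] (𝟙 (¬? (isZeroVec? v)) * ψ (w̃ v)) ≡ ∑[ a ∈ oneTo Mw ] (cardD a m * ψ a)
  ∑-nonzero-byWeight m ψ = begin
    ∑[ v ∈ allVecs m ] (𝟙 (¬? (isZeroVec? v)) * ψ (w̃ v))
      ≡⟨ ∑-cong (allVecs m) (λ v → trans (cong (_* ψ (w̃ v)) (𝟙-nonzero≡count-w̃ v))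
                                           (sym (ℕ-Multiplicity.∑-δ (oneTo Mw) (w̃ v) ψ))) ⟩
    ∑[ v ∈ allVecs m ] ∑[ a ∈ oneTo Mw ] (ℕ-Multiplicity.δ a (w̃ v) * ψ a)
      ≡⟨ ∑-comm (allVecs m) (oneTo Mw) _ ⟩
    ∑[ a ∈ oneTo Mw ] ∑[ v ∈ allVecs m ] (ℕ-Multiplicity.δ a (w̃ v) * ψ a)
      ≡⟨ ∑-cong (oneTo Mw) (λ a → trans (∑-*ʳ (allVecs m) (ψ a) _) (cong (_* ψ a) (cardD≡ a))) ⟩
    ∑[ a ∈ oneTo Mw ] (cardD a m * ψ a) ∎
    where
    cardD≡ : ∀ a → ∑[ v ∈ allVecs m ] ℕ-Multiplicity.δ a (w̃ v) ≡ cardD a m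
    cardD≡ a = trans (∑-cong (allVecs m) (λ v → ℕ-Multiplicity.δ-sym a (w̃ v)))
                     (sym (length-filter≡∑𝟙 (λ u → w̃ u ≟ a) (allVecs m)))

  ∑-allVecs : ∀ m (Ψ : Bool → ℕ → ℕ) →
    ∑[ v ∈ allVecs m ] Ψ (nonzero v) (w̃ v) ≡ Ψ false 0 + ∑[ a ∈ oneTo Mw ] (cardD a m * Ψ true a)
  ∑-allVecs m Ψ = begin
    ∑[ v ∈ allVecs m ] Ψ (nonzero v) (w̃ v)
      ≡⟨ ∑-cong (allVecs m) split ⟩
    ∑[ v ∈ allVecs m ] (𝟙 (isZeroVec? v) * Ψ false 0 + 𝟙 (¬? (isZeroVec? v)) * Ψ true (w̃ v))
      ≡⟨ ∑-+ (allVecs m) _ _ ⟩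
    ∑[ v ∈ allVecs m ] (𝟙 (isZeroVec? v) * Ψ false 0) + ∑[ v ∈ allVecs m ] (𝟙 (¬? (isZeroVec? v)) * Ψ true (w̃ v))
      ≡⟨ cong₂ _+_ (trans (∑-*ʳ (allVecs m) (Ψ false 0) _) (cong (_* Ψ false 0) (∑-isZeroVec m)))
                   (∑-nonzero-byWeight m (Ψ true)) ⟩
    1 * Ψ false 0 + ∑[ a ∈ oneTo Mw ] (cardD a m * Ψ true a)
      ≡⟨ cong (_+ ∑[ a ∈ oneTo Mw ] (cardD a m * Ψ true a)) (*-identityˡ (Ψ false 0)) ⟩
    Ψ false 0 + ∑[ a ∈ oneTo Mw ] (cardD a m * Ψ true a) ∎
    where
    split : ∀ v → Ψ (nonzero v) (w̃ v) ≡ 𝟙 (isZeroVec? v) * Ψ false 0 + 𝟙 (¬? (isZeroVec? v)) * Ψ true (w̃ v)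
    split v with isZeroVec? v
    ... | yes v≡0 rewrite w̃-zero v≡0 = sym (trans (+-identityʳ _) (+-identityʳ _))
    ... | no  _   = sym (*-identityˡ _)

  support : ∀ {n} {k : Fin n → ℕ} → ((i : Fin n) → Vec Carrier (k i)) → Subset n
  support x = tabulate (λ i → nonzero (x i))

  totalWeight : ∀ {n} {k : Fin n → ℕ} → ((i : Fin n) → Vec Carrier (k i)) → ℕ
  totalWeight {n} x = ∑[ i ∈ allFin n ] w̃ (x i)

  -- φ of the total weight, summed over tuples of nonzero vectors of dimensions ds
  -- and grouped by the weights of the vectors
  compositionSum : List ℕ → (ℕ → ℕ) → ℕ
  compositionSum ds φ = ∑[ cs ∈ listsOver (oneTo Mw) (length ds) ] (product (zipWith cardD cs ds) * φ (sum cs))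

  compositionSum-∷ : ∀ d ds φ →
    compositionSum (d ∷ ds) φ ≡ ∑[ a ∈ oneTo Mw ] (cardD a d * compositionSum ds (λ t → φ (a + t)))
  compositionSum-∷ d ds φ = begin
    ∑[ cs ∈ concatMap (λ a → map (a ∷_) L) (oneTo Mw) ] (product (zipWith cardD cs (d ∷ ds)) * φ (sum cs))
      ≡⟨ ∑-concatMap (λ a → map (a ∷_) L) (oneTo Mw) _ ⟩
    ∑[ a ∈ oneTo Mw ] ∑[ cs ∈ map (a ∷_) L ] (product (zipWith cardD cs (d ∷ ds)) * φ (sum cs))
      ≡⟨ ∑-cong (oneTo Mw) (λ a → ∑-map (a ∷_) L _) ⟩
    ∑[ a ∈ oneTo Mw ] ∑[ cs ∈ L ] (cardD a d * ∏D cs * φ (a + sum cs))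
      ≡⟨ ∑-cong (oneTo Mw) (λ a → trans (∑-cong L (λ cs → *-assoc (cardD a d) (∏D cs) _)) (∑-*ˡ L (cardD a d) _)) ⟩
    ∑[ a ∈ oneTo Mw ] (cardD a d * compositionSum ds (λ t → φ (a + t))) ∎
    where
    L = listsOver (oneTo Mw) (length ds)
    ∏D : List ℕ → ℕ
    ∏D cs = product (zipWith cardD cs ds)

  compositionSum-*ˡ : ∀ ds c φ → compositionSum ds (λ t → c * φ t) ≡ c * compositionSum ds φ
  compositionSum-*ˡ ds c φ = trans (∑-cong L (λ cs → x*yz≡y*xz (product (zipWith cardD cs ds)) c (φ (sum cs)))) (∑-*ˡ L c _)
    where L = listsOver (oneTo Mw) (length ds)

  compositionSum-[] : ∀ {ds r} → length ds ≡ 0 → 1 ≤ r → compositionSum ds (λ t → 𝟙 (t ≟ r)) ≡ 0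
  compositionSum-[] {[]} refl (s≤s z≤n) = refl

  ∑-allVecs-compositionSum : ∀ d ds (Ψ : Bool → ℕ → ℕ) →
    ∑[ v ∈ allVecs d ] compositionSum ds (λ t → Ψ (nonzero v) (w̃ v + t))
      ≡ compositionSum ds (Ψ false) + compositionSum (d ∷ ds) (Ψ true)
  ∑-allVecs-compositionSum d ds Ψ = begin
    ∑[ v ∈ allVecs d ] ∑[ cs ∈ L ] (∏D cs * Ψ (nonzero v) (w̃ v + sum cs))
      ≡⟨ ∑-comm (allVecs d) L _ ⟩
    ∑[ cs ∈ L ] ∑[ v ∈ allVecs d ] (∏D cs * Ψ (nonzero v) (w̃ v + sum cs))
      ≡⟨ ∑-cong L (λ cs → trans (∑-*ˡ (allVecs d) (∏D cs) _)
                                (cong (∏D cs *_) (∑-allVecs d (λ b s → Ψ b (s + sum cs))))) ⟩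
    ∑[ cs ∈ L ] (∏D cs * (Ψ false (sum cs) + ∑[ a ∈ oneTo Mw ] (cardD a d * Ψ true (a + sum cs))))
      ≡⟨ trans (∑-cong L (λ cs → *-distribˡ-+ (∏D cs) _ _)) (∑-+ L _ _) ⟩
    compositionSum ds (Ψ false) + ∑[ cs ∈ L ] (∏D cs * ∑[ a ∈ oneTo Mw ] (cardD a d * Ψ true (a + sum cs)))
      ≡⟨ cong (compositionSum ds (Ψ false) +_) (begin
           ∑[ cs ∈ L ] (∏D cs * ∑[ a ∈ oneTo Mw ] (cardD a d * Ψ true (a + sum cs)))
             ≡⟨ ∑-cong L (λ cs → sym (∑-*ˡ (oneTo Mw) (∏D cs) _)) ⟩
           ∑[ cs ∈ L ] ∑[ a ∈ oneTo Mw ] (∏D cs * (cardD a d * Ψ true (a + sum cs)))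
             ≡⟨ ∑-comm L (oneTo Mw) _ ⟩
           ∑[ a ∈ oneTo Mw ] ∑[ cs ∈ L ] (∏D cs * (cardD a d * Ψ true (a + sum cs)))
             ≡⟨ ∑-cong (oneTo Mw) (λ a → trans (∑-cong L (λ cs → x*yz≡y*xz (∏D cs) (cardD a d) _)) (∑-*ˡ L (cardD a d) _)) ⟩
           ∑[ a ∈ oneTo Mw ] (cardD a d * compositionSum ds (λ t → Ψ true (a + t)))
             ≡⟨ compositionSum-∷ d ds (Ψ true) ⟨
           compositionSum (d ∷ ds) (Ψ true) ∎) ⟩
    compositionSum ds (Ψ false) + compositionSum (d ∷ ds) (Ψ true) ∎
    where
    L = listsOver (oneTo Mw) (length ds)
    ∏D : List ℕ → ℕ
    ∏D cs = product (zipWith cardD cs ds)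

  ∑-allBlocks : ∀ n (k : Fin n → ℕ) (Φ : Subset n → ℕ → ℕ) →
    ∑[ x ∈ allBlocks n k ] Φ (support x) (totalWeight x) ≡ ∑[ S ∈ allSubsets n ] compositionSum (blockDims k S) (Φ S)
  ∑-allBlocks zero    k Φ = cong (_+ 0) (sym (trans (+-identityʳ _) (*-identityˡ (Φ [] 0))))
  ∑-allBlocks (suc n) k Φ = begin
    ∑[ x ∈ allBlocks (suc n) k ] Φ (support x) (totalWeight x)
      ≡⟨ ∑-concatMap (λ v → map (consB {n} {k} v) (allBlocks n (k ∘ suc))) (allVecs (k zero)) _ ⟩
    ∑[ v ∈ allVecs (k zero) ] ∑[ x ∈ map (consB {n} {k} v) (allBlocks n (k ∘ suc)) ] Φ (support x) (totalWeight x)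
      ≡⟨ ∑-cong (allVecs (k zero)) (λ v → trans (∑-map (consB {n} {k} v) (allBlocks n (k ∘ suc)) _)
            (∑-cong (allBlocks n (k ∘ suc)) (λ x → cong (Φ (nonzero v ∷ support x)) (∑-allFin-suc (λ i → w̃ (consB {n} {k} v x i)))))) ⟩
    ∑[ v ∈ allVecs (k zero) ] ∑[ x ∈ allBlocks n (k ∘ suc) ] Φ (nonzero v ∷ support x) (w̃ v + totalWeight x)
      ≡⟨ ∑-cong (allVecs (k zero)) (λ v → ∑-allBlocks n (k ∘ suc) (λ S t → Φ (nonzero v ∷ S) (w̃ v + t))) ⟩
    ∑[ v ∈ allVecs (k zero) ] ∑[ S ∈ allSubsets n ] compositionSum (blockDims (k ∘ suc) S) (λ t → Φ (nonzero v ∷ S) (w̃ v + t))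
      ≡⟨ ∑-comm (allVecs (k zero)) (allSubsets n) _ ⟩
    ∑[ S ∈ allSubsets n ] ∑[ v ∈ allVecs (k zero) ] compositionSum (blockDims (k ∘ suc) S) (λ t → Φ (nonzero v ∷ S) (w̃ v + t))
      ≡⟨ ∑-cong (allSubsets n) (λ S → ∑-allVecs-compositionSum (k zero) (blockDims (k ∘ suc) S) (λ b → Φ (b ∷ S))) ⟩
    ∑[ S ∈ allSubsets n ] (R (false ∷ S) + R (true ∷ S))
      ≡⟨ trans (∑-+ (allSubsets n) (R ∘ (false ∷_)) (R ∘ (true ∷_))) (+-comm (∑ (allSubsets n) (R ∘ (false ∷_))) _) ⟩
    ∑[ S ∈ allSubsets n ] R (true ∷ S) + ∑[ S ∈ allSubsets n ] R (false ∷ S)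
      ≡⟨ ∑-allSubsets-suc R ⟨
    ∑[ S ∈ allSubsets (suc n) ] R S ∎
    where
    R : Subset (suc n) → ℕ
    R S = compositionSum (blockDims k S) (Φ S)

-- Ideals of a finite poset

module _ {n : ℕ} {P : Fin n → Set p} (P? : ∀ i → Dec (P i)) where

  ∈-tabulate⁻ : ∀ {i} → i ∈ₛ tabulate (does ∘ P?) → P i
  ∈-tabulate⁻ {i} i∈ with P? i | trans (sym (lookup∘tabulate (does ∘ P?) i)) ([]=⇒lookup i∈)
  ... | yes Pi | _ = Pi

  ∈-tabulate⁺ : ∀ {i} → P i → i ∈ₛ tabulate (does ∘ P?)
  ∈-tabulate⁺ {i} Pi = lookup⇒[]= i _ (trans (lookup∘tabulate (does ∘ P?) i) (dec-true (P? i) Pi))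

module Ideals {n : ℕ} (_≼_ : Rel (Fin n) 0ℓ) (isDPO : IsDecPartialOrder _≡_ _≼_) where
  module ≼ = IsDecPartialOrder isDPO
  open PosetDefs _≼_ isDPO

  IsMaximalIn : Subset n → Fin n → Set
  IsMaximalIn I m = m ∈ₛ I × (∀ j → j ∈ₛ I → m ≼ j → j ≡ m)

  ∈⟨⟩⁻ : ∀ {A i} → i ∈ₛ ⟨ A ⟩ → ∃ λ a → a ∈ₛ A × i ≼ a
  ∈⟨⟩⁻ {A} = ∈-tabulate⁻ (λ i → any? (λ a → (a ∈? A) ×-dec (i ≼.≤? a)))

  ∈⟨⟩⁺ : ∀ {A i a} → a ∈ₛ A → i ≼ a → i ∈ₛ ⟨ A ⟩
  ∈⟨⟩⁺ {A} a∈ i≼a = ∈-tabulate⁺ (λ i → any? (λ a → (a ∈? A) ×-dec (i ≼.≤? a))) (_ , a∈ , i≼a)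

  ∈Max⁻ : ∀ {I m} → m ∈ₛ Max I → IsMaximalIn I m
  ∈Max⁻ {I} = ∈-tabulate⁻ (λ m → (m ∈? I) ×-dec all? (λ j → (j ∈? I) →-dec ((m ≼.≤? j) →-dec (j ≼.≟ m))))

  ∈Max⁺ : ∀ {I m} → IsMaximalIn I m → m ∈ₛ Max I
  ∈Max⁺ {I} = ∈-tabulate⁺ (λ m → (m ∈? I) ×-dec all? (λ j → (j ∈? I) →-dec ((m ≼.≤? j) →-dec (j ≼.≟ m))))

  ⊆⟨⟩ : ∀ A → A ⊆ ⟨ A ⟩
  ⊆⟨⟩ A i∈ = ∈⟨⟩⁺ i∈ ≼.refl

  ⟨⟩-isIdeal : ∀ A → IsIdeal ⟨ A ⟩
  ⟨⟩-isIdeal A i j i∈ j≼i with a , a∈ , i≼a ← ∈⟨⟩⁻ i∈ = ∈⟨⟩⁺ a∈ (≼.trans j≼i i≼a)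

  isIdeal⇒⟨⟩⊆ : ∀ {I} → IsIdeal I → ⟨ I ⟩ ⊆ I
  isIdeal⇒⟨⟩⊆ I-ideal i∈ with a , a∈ , i≼a ← ∈⟨⟩⁻ i∈ = I-ideal a _ a∈ i≼a

  Max⊆ : ∀ I → Max I ⊆ I
  Max⊆ I = proj₁ ∘ ∈Max⁻

  Max⟨⟩⊆ : ∀ A → Max ⟨ A ⟩ ⊆ A
  Max⟨⟩⊆ A m∈ with m∈⟨A⟩ , m-max ← ∈Max⁻ m∈ with a , a∈ , m≼a ← ∈⟨⟩⁻ m∈⟨A⟩ =
    subst (_∈ₛ A) (m-max a (⊆⟨⟩ A a∈) m≼a) a∈

  upSet : Fin n → Subset n
  upSet i = tabulate (does ∘ (i ≼.≤?_))

  ≺⇒∣upSet∣> : ∀ {i j} → i ≼ j → j ≢ i → ∣ upSet j ∣ < ∣ upSet i ∣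
  ≺⇒∣upSet∣> {i} {j} i≼j j≢i = p⊂q⇒∣p∣<∣q∣
    ( (λ l∈ → ∈-tabulate⁺ (i ≼.≤?_) (≼.trans i≼j (∈-tabulate⁻ (j ≼.≤?_) l∈)))
    , i , ∈-tabulate⁺ (i ≼.≤?_) ≼.refl
    , λ i∈ → j≢i (≼.antisym (∈-tabulate⁻ (j ≼.≤?_) i∈) i≼j))

  -- climb strictly upwards inside I; the up-set shrinks at every step
  ≼-maximal : ∀ {I i} → i ∈ₛ I → ∃ λ m → m ∈ₛ Max I × i ≼ m
  ≼-maximal {I} {i} i∈ = climb (suc ∣ upSet i ∣) i ≤-refl i∈
    where
    climb : ∀ fuel i → ∣ upSet i ∣ < fuel → i ∈ₛ I → ∃ λ m → m ∈ₛ Max I × i ≼ m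
    climb (suc fuel) i bound i∈ with any? (λ j → (j ∈? I) ×-dec (i ≼.≤? j) ×-dec ¬? (j ≼.≟ i))
    ... | yes (j , j∈ , i≼j , j≢i) with m , m∈ , j≼m ← climb fuel j (≤-trans (≺⇒∣upSet∣> i≼j j≢i) (≤-pred bound)) j∈ =
      m , m∈ , ≼.trans i≼j j≼m
    ... | no  ∄j = i , ∈Max⁺ (i∈ , maximal) , ≼.refl
      where
      maximal : ∀ j → j ∈ₛ I → i ≼ j → j ≡ i
      maximal j j∈ i≼j with j ≼.≟ i
      ... | yes j≡i = j≡i
      ... | no  j≢i = ⊥-elim (∄j (j , j∈ , i≼j , j≢i))

-- The (P,w,π)-weight below M_w

module Proposition33 (F : FiniteField) (W : Weight F) {n : ℕ}
                     (_≼_ : Rel (Fin n) 0ℓ) (isDPO : IsDecPartialOrder _≡_ _≼_)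
                     (k : Fin n → ℕ) (r : ℕ) where
  open FiniteField F using (0#)
  open WeightDefs F W
  open PosetDefs _≼_ isDPO
  open Prop33 F W _≼_ isDPO k
  open Weights F W
  open Ideals _≼_ isDPO
  open Partitions F W r

  IsAntichainIdeal : Subset n → Set
  IsAntichainIdeal S = IsIdeal S × ∣ Max S ∣ ≡ ∣ S ∣

  antichainIdeal? : (S : Subset n) → Dec (IsAntichainIdeal S)
  antichainIdeal? S = isIdeal? S ×-dec (∣ Max S ∣ ≟ ∣ S ∣)

  antichainIdealSum : ℕ
  antichainIdealSum = ∑[ S ∈ allSubsets n ] (𝟙 (antichainIdeal? S) * compositionSum (blockDims k S) (λ t → 𝟙 (t ≟ r)))

  ∈supp⇒nonzero : ∀ x {i} → i ∈ₛ supp x → ¬ VecAll (_≡ 0#) (x i)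
  ∈supp⇒nonzero x = ∈-tabulate⁻ (λ i → ¬? (isZeroVec? (x i)))

  ∑-elems-supp : ∀ x → ∑[ i ∈ elems (supp x) ] w̃ (x i) ≡ totalWeight x
  ∑-elems-supp x = trans (∑-filter (_∈? supp x) (allFin n) (λ i → w̃ (x i))) (∑-cong (allFin n) off-supp)
    where
    off-supp : ∀ i → 𝟙 (i ∈? supp x) * w̃ (x i) ≡ w̃ (x i)
    off-supp i with i ∈? supp x
    ... | yes _   = *-identityˡ _
    ... | no  i∉ = sym (w̃-zero (decidable-stable (isZeroVec? (x i)) (i∉ ∘ ∈-tabulate⁺ (λ i → ¬? (isZeroVec? (x i))))))

  wP≤Mw⇒Ix⊆Mx : ∀ x → wP x ≤ Mw → Ix x ⊆ Mx x
  wP≤Mw⇒Ix⊆Mx x wP≤Mw {i} i∈ with i ∈? Mx x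
  ... | yes i∈M = i∈M
  ... | no  i∉M with m , m∈ , _ ← ≼-maximal i∈ = ⊥-elim (≤⇒≯ wP≤Mw (+-mono-≤ 1≤∑ Mw≤))
    where
    1≤∑ : 1 ≤ ∑[ j ∈ elems (Mx x) ] w̃ (x j)
    1≤∑ = ≤-trans (nonzero⇒w̃≥1 (x m) (∈supp⇒nonzero x (Max⟨⟩⊆ (supp x) m∈)))
                  (∈⇒≤∑ (elems (Mx x)) (λ j → w̃ (x j)) (∈-filter⁺ (_∈? Mx x) (∈-allFin m) m∈))
    Mw≤ : Mw ≤ ∣ Ix x ─ Mx x ∣ * Mw
    Mw≤ = ≤-trans (≤-reflexive (sym (*-identityˡ Mw))) (*-monoˡ-≤ Mw (∈⇒1≤∣∣ (x∈p∧x∉q⇒x∈p─q i∈ i∉M)))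

  wP≤Mw⇒antichainIdeal : ∀ x → wP x ≤ Mw → IsAntichainIdeal (supp x)
  wP≤Mw⇒antichainIdeal x wP≤Mw =
    subst IsIdeal (sym supp≡Ix) (⟨⟩-isIdeal (supp x)) , cong ∣_∣ (trans (cong Max supp≡Ix) Mx≡supp)
    where
    supp≡Ix : supp x ≡ Ix x
    supp≡Ix = ⊆-antisym (⊆⟨⟩ (supp x)) (Max⟨⟩⊆ (supp x) ∘ wP≤Mw⇒Ix⊆Mx x wP≤Mw)
    Mx≡supp : Mx x ≡ supp x
    Mx≡supp = ⊆-antisym (Max⟨⟩⊆ (supp x)) (wP≤Mw⇒Ix⊆Mx x wP≤Mw ∘ ⊆⟨⟩ (supp x))

  antichainIdeal⇒wP≡totalWeight : ∀ x → IsAntichainIdeal (supp x) → wP x ≡ totalWeight x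
  antichainIdeal⇒wP≡totalWeight x (supp-ideal , ∣Max∣≡∣supp∣) = begin
    wP x
      ≡⟨ cong₂ (λ I M → ∑[ i ∈ elems M ] w̃ (x i) + ∣ I ─ M ∣ * Mw) Ix≡supp Mx≡supp ⟩
    ∑[ i ∈ elems (supp x) ] w̃ (x i) + ∣ supp x ─ supp x ∣ * Mw
      ≡⟨ cong (λ c → ∑[ i ∈ elems (supp x) ] w̃ (x i) + c * Mw) (∣p─p∣≡0 (supp x)) ⟩
    ∑[ i ∈ elems (supp x) ] w̃ (x i) + 0
      ≡⟨ trans (+-identityʳ _) (∑-elems-supp x) ⟩
    totalWeight x ∎
    where
    Ix≡supp : Ix x ≡ supp x
    Ix≡supp = ⊆-antisym (isIdeal⇒⟨⟩⊆ supp-ideal) (⊆⟨⟩ (supp x))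
    Mx≡supp : Mx x ≡ supp x
    Mx≡supp = trans (cong Max Ix≡supp) (⊆∧∣∣≡⇒≡ (Max⊆ (supp x)) ∣Max∣≡∣supp∣)

  𝟙-wP≡r : r ≤ Mw → ∀ x → 𝟙 (wP x ≟ r) ≡ 𝟙 (antichainIdeal? (supp x)) * 𝟙 (totalWeight x ≟ r)
  𝟙-wP≡r r≤Mw x = trans
    (𝟙-⇔ (wP x ≟ r) (antichainIdeal? (supp x) ×-dec (totalWeight x ≟ r))
      (λ wP≡r → let antichain = wP≤Mw⇒antichainIdeal x (subst (_≤ Mw) (sym wP≡r) r≤Mw) in
                antichain , trans (sym (antichainIdeal⇒wP≡totalWeight x antichain)) wP≡r)
      (λ (antichain , tw≡r) → trans (antichainIdeal⇒wP≡totalWeight x antichain) tw≡r))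
    (𝟙-× (antichainIdeal? (supp x)) (totalWeight x ≟ r))

  cardA≡antichainIdealSum : r ≤ Mw → cardA r ≡ antichainIdealSum
  cardA≡antichainIdealSum r≤Mw = begin
    cardA r
      ≡⟨ length-filter≡∑𝟙 (λ x → wP x ≟ r) (allBlocks n k) ⟩
    ∑[ x ∈ allBlocks n k ] 𝟙 (wP x ≟ r)
      ≡⟨ ∑-cong (allBlocks n k) (𝟙-wP≡r r≤Mw) ⟩
    ∑[ x ∈ allBlocks n k ] (𝟙 (antichainIdeal? (supp x)) * 𝟙 (totalWeight x ≟ r))
      ≡⟨ ∑-allBlocks n k (λ S t → 𝟙 (antichainIdeal? S) * 𝟙 (t ≟ r)) ⟩
    ∑[ S ∈ allSubsets n ] compositionSum (blockDims k S) (λ t → 𝟙 (antichainIdeal? S) * 𝟙 (t ≟ r))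
      ≡⟨ ∑-cong (allSubsets n) (λ S → compositionSum-*ˡ (blockDims k S) (𝟙 (antichainIdeal? S)) (λ t → 𝟙 (t ≟ r))) ⟩
    antichainIdealSum ∎

  prodD≡ : ∀ I cs → prodD I cs ≡ product (zipWith cardD cs (blockDims k I))
  prodD≡ I cs = cong product (begin
    zipWith (λ c i → cardD c (k i)) cs (elems I)            ≡⟨ List.zipWith-map cardD id k cs (elems I) ⟨
    zipWith cardD (map id cs) (map k (elems I))             ≡⟨ cong₂ (zipWith cardD) (List.map-id cs) (map-elems≡blockDims k I) ⟩
    zipWith cardD cs (blockDims k I)                        ∎)

  arrangementSum : ℕ → Subset n → ℕ
  arrangementSum j I = ∑[ bs ∈ filter (λ bs → length bs ≟ j) (PRT n 0 r) ] ∑[ cs ∈ ARG bs ] prodD I cs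

  -- the empty ideal (∣ I ∣ = 0 ∉ oneTo n) is harmless because r ≥ 1
  count-oneTo*arrangementSum : 1 ≤ r → ∀ I →
    ℕ-Multiplicity.count (∣ I ∣) (oneTo n) * arrangementSum (∣ I ∣) I ≡ compositionSum (blockDims k I) (λ t → 𝟙 (t ≟ r))
  count-oneTo*arrangementSum 1≤r I with ∣ I ∣ in ∣I∣≡ | length-blockDims k I
  ... | zero | length≡0 = trans
    (cong (_* arrangementSum 0 I) (ℕ-Multiplicity.count-∉ 0 (oneTo n) (λ 0∈ → 1+n≰n (proj₁ (∈-oneTo⁻ 0∈)))))
    (sym (compositionSum-[] {blockDims k I} length≡0 1≤r))
  ... | suc j | length≡ = begin
    ℕ-Multiplicity.count (suc j) (oneTo n) * arrangementSum (suc j) I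
      ≡⟨ cong (_* arrangementSum (suc j) I) (count-oneTo (s≤s z≤n) 1+j≤n) ⟩
    1 * arrangementSum (suc j) I
      ≡⟨ *-identityˡ _ ⟩
    arrangementSum (suc j) I
      ≡⟨ ∑-PRT-ARG n (suc j) (s≤s z≤n) 1+j≤n (prodD I) ⟩
    ∑[ cs ∈ compositions (suc j) ] (𝟙 (sum cs ≟ r) * prodD I cs)
      ≡⟨ ∑-cong (compositions (suc j)) (λ cs → trans (*-comm (𝟙 (sum cs ≟ r)) _) (cong (_* 𝟙 (sum cs ≟ r)) (prodD≡ I cs))) ⟩
    ∑[ cs ∈ compositions (suc j) ] (product (zipWith cardD cs (blockDims k I)) * 𝟙 (sum cs ≟ r))
      ≡⟨ cong (λ l → ∑[ cs ∈ compositions l ] (product (zipWith cardD cs (blockDims k I)) * 𝟙 (sum cs ≟ r))) length≡ ⟨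
    compositionSum (blockDims k I) (λ t → 𝟙 (t ≟ r)) ∎
    where
    1+j≤n : suc j ≤ n
    1+j≤n = subst (_≤ n) ∣I∣≡ (∣p∣≤n I)

  rhs≡antichainIdealSum : 1 ≤ r → rhs r ≡ antichainIdealSum
  rhs≡antichainIdealSum 1≤r = begin
    rhs r
      ≡⟨ ∑-cong (oneTo n) (λ j → ∑-filter (ideal? j) (allSubsets n) (arrangementSum j)) ⟩
    ∑[ j ∈ oneTo n ] ∑[ I ∈ allSubsets n ] (𝟙 (ideal? j I) * arrangementSum j I)
      ≡⟨ ∑-comm (oneTo n) (allSubsets n) _ ⟩
    ∑[ I ∈ allSubsets n ] ∑[ j ∈ oneTo n ] (𝟙 (ideal? j I) * arrangementSum j I)
      ≡⟨ ∑-cong (allSubsets n) sizes ⟩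
    antichainIdealSum ∎
    where
    ideal? : ∀ j (I : Subset n) → Dec (IsIdeal I × ∣ I ∣ ≡ j × ∣ Max I ∣ ≡ j)
    ideal? j I = isIdeal? I ×-dec ((∣ I ∣ ≟ j) ×-dec (∣ Max I ∣ ≟ j))
    𝟙-ideal? : ∀ I j → 𝟙 (ideal? j I) ≡ 𝟙 (antichainIdeal? I) * ℕ-Multiplicity.δ j (∣ I ∣)
    𝟙-ideal? I j = trans
      (𝟙-⇔ (ideal? j I) (antichainIdeal? I ×-dec (j ≟ ∣ I ∣))
        (λ (I-ideal , ∣I∣≡j , ∣MaxI∣≡j) → (I-ideal , trans ∣MaxI∣≡j (sym ∣I∣≡j)) , sym ∣I∣≡j)
        (λ ((I-ideal , ∣MaxI∣≡∣I∣) , j≡∣I∣) → I-ideal , sym j≡∣I∣ , trans ∣MaxI∣≡∣I∣ (sym j≡∣I∣)))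
      (𝟙-× (antichainIdeal? I) (j ≟ ∣ I ∣))
    sizes : ∀ I → ∑[ j ∈ oneTo n ] (𝟙 (ideal? j I) * arrangementSum j I)
                ≡ 𝟙 (antichainIdeal? I) * compositionSum (blockDims k I) (λ t → 𝟙 (t ≟ r))
    sizes I = begin
      ∑[ j ∈ oneTo n ] (𝟙 (ideal? j I) * arrangementSum j I)
        ≡⟨ ∑-cong (oneTo n) (λ j → trans (cong (_* arrangementSum j I) (𝟙-ideal? I j))
                                                (*-assoc (𝟙 (antichainIdeal? I)) _ _)) ⟩
      ∑[ j ∈ oneTo n ] (𝟙 (antichainIdeal? I) * (ℕ-Multiplicity.δ j (∣ I ∣) * arrangementSum j I))
        ≡⟨ ∑-*ˡ (oneTo n) (𝟙 (antichainIdeal? I)) _ ⟩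
      𝟙 (antichainIdeal? I) * ∑[ j ∈ oneTo n ] (ℕ-Multiplicity.δ j (∣ I ∣) * arrangementSum j I)
        ≡⟨ cong (𝟙 (antichainIdeal? I) *_) (ℕ-Multiplicity.∑-δ (oneTo n) (∣ I ∣) (λ j → arrangementSum j I)) ⟩
      𝟙 (antichainIdeal? I) * (ℕ-Multiplicity.count (∣ I ∣) (oneTo n) * arrangementSum (∣ I ∣) I)
        ≡⟨ cong (𝟙 (antichainIdeal? I) *_) (count-oneTo*arrangementSum 1≤r I) ⟩
      𝟙 (antichainIdeal? I) * compositionSum (blockDims k I) (λ t → 𝟙 (t ≟ r)) ∎

proposition3p3 : (F : FiniteField) (W : Weight F) (n : ℕ)
    (_≼_ : Rel (Fin n) 0ℓ) (isDPO : IsDecPartialOrder _≡_ _≼_)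
    (k : Fin n → ℕ) → (∀ i → 1 ≤ k i) →
    (r : ℕ) → 1 ≤ r → r ≤ WeightDefs.Mw F W →
    Prop33.cardA F W _≼_ isDPO k r ≡ Prop33.rhs F W _≼_ isDPO k r
proposition3p3 F W n _≼_ isDPO k _ r 1≤r r≤Mw =
  trans (cardA≡antichainIdealSum r≤Mw) (sym (rhs≡antichainIdealSum 1≤r))
  where open Proposition33 F W _≼_ isDPO k r
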